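{- For every positive integer $n$, with home state the fully horizontal state, the lattice of states of $QR_n$ is isomorphic to the poset on the subsets of $[n]$ in which $A\le B$ if and only if $w(A)\ge w(B)$ coordinatewise.
   Context: The robotic arm $QR_n$: $n$ unit links with base at $(0,0)$, each facing north or east; a state is labelled by the set $A\subseteq[n]$ of indices of north links. Moves: interchange two consecutive links $i,i+1$ that are N,E or E,N; switch the last link between E and N. The transition graph has states as vertices and edges between states differing by one move. With home state $u$ the fully horizontal state ($A=\emptyset$), the poset of states is defined by $p\le q$ iff some shortest edge-path in the transition graph from $u$ to $q$ passes through $p$. For $A=\{a_1<a_2<\cdots<a_k\}\subseteq[n]$, the word of $A$ is the length-$n$ integer vector $w(A)=(a_1,a_2,\dots,a_k,n+1,n+1,\dots,n+1)$. -}

module Defs where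

open import Data.Nat using (ℕ; zero; suc; _≤_; _∸_)
open import Data.Bool using (Bool; true; false; not; if_then_else_)
open import Data.Fin using (Fin; toℕ)
open import Data.Vec using (Vec; []; _∷_; lookup; replicate; tabulate; _[_]≔_)
open import Data.List using (List; []; _∷_)
open import Data.Product using (Σ; _×_; ∃; _,_)
open import Relation.Binary.PropositionalEquality using (_≡_)
open import Relation.Nullary using (¬_)

-- A state of QR_n: position i : Fin n (link number toℕ i + 1) is true iff that link is North.
-- So a state is the characteristic vector of A ⊆ [n].
State : ℕ → Set
State n = Vec Bool n

home : (n : ℕ) → State n
home n = replicate n false

-- One move (edge of the transition graph).  Both kinds of move are involutions,
-- so this relation is symmetric (the graph is undirected).
data Adj {n : ℕ} (A B : State n) : Set where
  swapMove : (i j : Fin n) → toℕ j ≡ suc (toℕ i) → ¬ (lookup A i ≡ lookup A j) →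
             B ≡ ((A [ i ]≔ lookup A j) [ j ]≔ lookup A i) → Adj A B
  lastMove : (l : Fin n) → suc (toℕ l) ≡ n → B ≡ (A [ l ]≔ not (lookup A l)) → Adj A B

data Walk {n : ℕ} : State n → State n → ℕ → Set where
  nil  : (s : State n) → Walk s s 0
  cons : {s t r : State n} {k : ℕ} → Adj s t → Walk t r k → Walk s r (suc k)

data Visits {n : ℕ} (p : State n) : {s r : State n} {k : ℕ} → Walk s r k → Set where
  here-nil  : Visits p (nil p)
  here-cons : {t r : State n} {k : ℕ} (e : Adj p t) (w : Walk t r k) → Visits p (cons e w)
  there     : {s t r : State n} {k : ℕ} (e : Adj s t) (w : Walk t r k) → Visits p w → Visits p (cons e w)

Shortest : {n : ℕ} (s r : State n) (k : ℕ) → Set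
Shortest s r k = (k' : ℕ) → Walk s r k' → k ≤ k'

_≤QR_ : {n : ℕ} → State n → State n → Set
_≤QR_ {n} p q = Σ ℕ λ k → Σ (Walk (home n) q k) λ w → Shortest (home n) q k × Visits p w

elemsFrom : {n : ℕ} → ℕ → State n → List ℕ
elemsFrom k [] = []
elemsFrom k (true ∷ v) = k ∷ elemsFrom (suc k) v
elemsFrom k (false ∷ v) = elemsFrom (suc k) v

nthOr : ℕ → List ℕ → ℕ → ℕ
nthOr d [] _ = d
nthOr d (x ∷ xs) zero = x
nthOr d (x ∷ xs) (suc m) = nthOr d xs m

word : {n : ℕ} → State n → Vec ℕ n
word {n} A = tabulate (λ j → nthOr (suc n) (elemsFrom 1 A) (toℕ j))

_≤W_ : {n : ℕ} → State n → State n → Set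
_≤W_ {n} A B = (j : Fin n) → lookup (word B) j ≤ lookup (word A) j

-- The distance from the home state to A is its height h(A) = Σ_{a ∈ A} (n + 1 − a):
-- every move changes h by exactly one, and the raising moves (E,N ↦ N,E, and E ↦ N
-- on the last link) never decrease a prefix count #(A ∩ [m]).  Conversely, if the
-- prefix counts of A are dominated by those of B, then B is reached from A by
-- h(B) − h(A) raising moves.  Hence p lies on a shortest path from home to q iff the
-- prefix counts of p are dominated by those of q, and this dominance order is the
-- reverse componentwise order on words, because a_{j+1} ≤ m iff #(A ∩ [m]) > j.
-- So the isomorphism is the identity.
module Submission where

open import Defs
open import Data.Nat using (ℕ; zero; suc; pred; _+_; _≤_; _<_; z≤n; s≤s; s≤s⁻¹; _≤?_)
open import Data.Nat.Properties
open import Data.Bool using (Bool; true; false; not)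
open import Data.Fin using (Fin; toℕ; fromℕ<) renaming (zero to fzero; suc to fsuc)
open import Data.Fin.Properties using (toℕ-fromℕ<)
open import Data.Vec using (Vec; []; _∷_; lookup; _[_]≔_)
open import Data.Vec.Properties using (lookup∘tabulate)
open import Data.Product using (Σ; _×_; _,_; proj₂)
open import Data.Empty using (⊥-elim)
open import Relation.Binary.PropositionalEquality
open import Relation.Nullary using (¬_; yes; no)
open import Function.Bundles using (_↔_; Inverse; _⇔_; Equivalence; mk⇔)
open import Function.Construct.Identity using (↔-id)

open Equivalence using (to; from)

private
  variable
    n k : ℕ
    x : Bool
    p q r s t v w : Vec Bool n

data Move : Vec Bool n → Vec Bool n → Set where
  flipLast  : (b : Bool) → Move (b ∷ []) (not b ∷ [])
  swapFront : {x y : Bool} → ¬ x ≡ y → Move (x ∷ y ∷ v) (y ∷ x ∷ v)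
  later     : Move v w → Move (x ∷ v) (x ∷ w)

swap⇒move : (A : Vec Bool n) (i j : Fin n) → toℕ j ≡ suc (toℕ i) → ¬ lookup A i ≡ lookup A j →
            Move A ((A [ i ]≔ lookup A j) [ j ]≔ lookup A i)
swap⇒move (x ∷ y ∷ v) fzero    (fsuc fzero) refl x≢y = swapFront x≢y
swap⇒move (x ∷ v)     (fsuc i) (fsuc j)     j≡1+i x≢y = later (swap⇒move v i j (suc-injective j≡1+i) x≢y)

flip⇒move : (A : Vec Bool n) (l : Fin n) → suc (toℕ l) ≡ n → Move A (A [ l ]≔ not (lookup A l))
flip⇒move (x ∷ [])    fzero    refl = flipLast x
flip⇒move (x ∷ v)     (fsuc l) 1+l≡n = later (flip⇒move v l (suc-injective 1+l≡n))

adj⇒move : Adj s t → Move s t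
adj⇒move {s = A} (swapMove i j j≡1+i x≢y refl) = swap⇒move A i j j≡1+i x≢y
adj⇒move {s = A} (lastMove l 1+l≡n refl)     = flip⇒move A l 1+l≡n

adj-∷ : Adj v w → Adj (x ∷ v) (x ∷ w)
adj-∷ {x = x} (swapMove i j j≡1+i x≢y eq) = swapMove (fsuc i) (fsuc j) (cong suc j≡1+i) x≢y (cong (x ∷_) eq)
adj-∷ {x = x} (lastMove l 1+l≡n eq)       = lastMove (fsuc l) (cong suc 1+l≡n) (cong (x ∷_) eq)

walk-∷ : Walk v w k → Walk (x ∷ v) (x ∷ w) k
walk-∷ (nil _)    = nil _
walk-∷ (cons e w) = cons (adj-∷ e) (walk-∷ w)

_++ʷ_ : ∀ {a b} → Walk s t a → Walk t r b → Walk s r (a + b)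
nil _    ++ʷ w′ = w′
cons e w ++ʷ w′ = cons e (w ++ʷ w′)

visits-++ : ∀ {a b} (w₁ : Walk s p a) (w₂ : Walk p r b) → Visits p (w₁ ++ʷ w₂)
visits-++ (nil _)     (nil _)    = here-nil
visits-++ (nil _)     (cons e w) = here-cons e w
visits-++ (cons e w₁) w₂         = there e _ (visits-++ w₁ w₂)

visits⇒split : (w : Walk s r k) → Visits p w →
               Σ ℕ λ a → Σ ℕ λ b → Walk s p a × Walk p r b × a + b ≡ k
visits⇒split (nil _)    here-nil            = 0 , 0 , nil _ , nil _ , refl
visits⇒split (cons e w) (here-cons .e .w)   = 0 , _ , nil _ , cons e w , refl
visits⇒split (cons e w) (there .e .w visit) with visits⇒split w visit
... | a , b , w₁ , w₂ , a+b≡k = suc a , b , cons e w₁ , w₂ , cong suc a+b≡k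

weight : Bool → ℕ → ℕ
weight true  n = suc n
weight false n = 0

height : Vec Bool n → ℕ
height []              = 0
height {suc n} (x ∷ v) = weight x n + height v

bit : Bool → ℕ
bit true  = 1
bit false = 0

prefix# : ℕ → Vec Bool n → ℕ
prefix# zero    v       = 0
prefix# (suc m) []      = 0
prefix# (suc m) (x ∷ v) = bit x + prefix# m v

_⊑_ : Vec Bool n → Vec Bool n → Set
p ⊑ q = ∀ m → prefix# m p ≤ prefix# m q

⊑-trans : p ⊑ q → q ⊑ r → p ⊑ r
⊑-trans p⊑q q⊑r m = ≤-trans (p⊑q m) (q⊑r m)

⊑-∷ : v ⊑ w → (x ∷ v) ⊑ (x ∷ w)
⊑-∷         v⊑w zero    = z≤n
⊑-∷ {x = x} v⊑w (suc m) = +-monoʳ-≤ (bit x) (v⊑w m)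

∷-⊑ : (x ∷ v) ⊑ (x ∷ w) → v ⊑ w
∷-⊑ {x = x} xv⊑xw m = +-cancelˡ-≤ (bit x) _ _ (xv⊑xw (suc m))

data Step (s t : Vec Bool n) : Set where
  up   : height t ≡ suc (height s) → s ⊑ t → Step s t
  down : suc (height t) ≡ height s → Step s t

move⇒step : Move s t → Step s t
move⇒step (flipLast false) = up refl λ { zero → z≤n ; (suc m) → n≤1+n _ }
move⇒step (flipLast true)  = down refl
move⇒step (swapFront {x = false} {true} _) = up refl λ { zero → z≤n ; (suc zero) → z≤n ; (suc (suc m)) → ≤-refl }
move⇒step (swapFront {x = true} {false} _) = down refl
move⇒step (swapFront {x = false} {false} x≢y) = ⊥-elim (x≢y refl)
move⇒step (swapFront {x = true} {true} x≢y)   = ⊥-elim (x≢y refl)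
move⇒step {suc n} (later {x = x} mv) with move⇒step mv
... | up e v⊑w = up (trans (cong (weight x n +_) e) (+-suc (weight x n) _)) (⊑-∷ v⊑w)
... | down e   = down (trans (sym (+-suc (weight x n) _)) (cong (weight x n +_) e))

adj⇒step : Adj s t → Step s t
adj⇒step e = move⇒step (adj⇒move e)

step⇒height≤ : Step s t → height t ≤ suc (height s)
step⇒height≤ (up e _) = ≤-reflexive e
step⇒height≤ (down e)   = ≤-trans (n≤1+n _) (≤-trans (≤-reflexive e) (n≤1+n _))

height-walk : Walk s r k → height r ≤ height s + k
height-walk {s = s} (nil _) = m≤m+n (height s) 0
height-walk {s = s} {r} {suc k} (cons {t = t} e w) = begin
  height r           ≤⟨ height-walk w ⟩
  height t + k       ≤⟨ +-monoˡ-≤ k (step⇒height≤ (adj⇒step e)) ⟩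
  suc (height s + k) ≡⟨ +-suc (height s) k ⟨
  height s + suc k   ∎
  where open ≤-Reasoning

-- A move raises the height by at most one, so every move of such a walk is raising.
tight-walk⇒⊑ : Walk p q k → height p + k ≤ height q → p ⊑ q
tight-walk⇒⊑ (nil _) _ m = ≤-refl
tight-walk⇒⊑ {p = p} {q} {suc k} (cons {t = t} e w) tight with adj⇒step e
... | up e↑ p⊑t = ⊑-trans p⊑t (tight-walk⇒⊑ w (begin
  height t + k       ≡⟨ cong (_+ k) e↑ ⟩
  suc (height p + k) ≡⟨ +-suc (height p) k ⟨
  height p + suc k   ≤⟨ tight ⟩
  height q           ∎))
  where open ≤-Reasoning
... | down e↓ = ⊥-elim (1+n≰n (begin-strict
  height t + k             <⟨ n<1+n _ ⟩
  suc (height t + k)       ≤⟨ n≤1+n _ ⟩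
  suc (suc (height t + k)) ≡⟨ cong suc (+-suc (height t) k) ⟨
  suc (height t) + suc k   ≡⟨ cong (_+ suc k) e↓ ⟩
  height p + suc k         ≤⟨ tight ⟩
  height q                 ≤⟨ height-walk w ⟩
  height t + k             ∎))
  where open ≤-Reasoning

Ascent : Vec Bool n → Vec Bool n → Set
Ascent p q = Σ ℕ λ k → Walk p q k × height p + k ≡ height q

ascent-∷ : Ascent v w → Ascent (x ∷ v) (x ∷ w)
ascent-∷ {x = x} (k , w , e) =
  k , walk-∷ w , trans (+-assoc (weight x _) _ k) (cong (weight x _ +_) e)

_⨾_ : Ascent p q → Ascent q r → Ascent p r
_⨾_ {p = p} (a , w₁ , e₁) (b , w₂ , e₂) =
  a + b , w₁ ++ʷ w₂ , trans (sym (+-assoc (height p) a b)) (trans (cong (_+ b) e₁) e₂)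

ascent-swapFront : ∀ {n} {v : Vec Bool n} → Ascent (false ∷ true ∷ v) (true ∷ false ∷ v)
ascent-swapFront {n = n} {v = v} =
  1 , cons (swapMove fzero (fsuc fzero) refl (λ ()) refl) (nil _) , +-comm (suc n + height v) 1

ascent-flipLast : Ascent (false ∷ []) (true ∷ [])
ascent-flipLast = 1 , cons (lastMove fzero refl refl) (nil _) , refl

dropFirstNorth : Vec Bool n → Vec Bool n
dropFirstNorth []          = []
dropFirstNorth (true ∷ v)  = false ∷ v
dropFirstNorth (false ∷ v) = false ∷ dropFirstNorth v

ascent-dropFirstNorth : (v : Vec Bool n) → Ascent (false ∷ v) (true ∷ dropFirstNorth v)
ascent-dropFirstNorth []          = ascent-flipLast
ascent-dropFirstNorth (true ∷ v)  = ascent-swapFront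
ascent-dropFirstNorth (false ∷ v) = ascent-∷ (ascent-dropFirstNorth v) ⨾ ascent-swapFront

prefix#-dropFirstNorth : ∀ m (v : Vec Bool n) → prefix# m (dropFirstNorth v) ≡ pred (prefix# m v)
prefix#-dropFirstNorth zero    v           = refl
prefix#-dropFirstNorth (suc m) []          = refl
prefix#-dropFirstNorth (suc m) (true ∷ v)  = refl
prefix#-dropFirstNorth (suc m) (false ∷ v) = prefix#-dropFirstNorth m v

⊑-dropFirstNorth : (false ∷ v) ⊑ (true ∷ w) → dropFirstNorth v ⊑ w
⊑-dropFirstNorth {v = v} v⊑w m rewrite prefix#-dropFirstNorth m v = pred-mono-≤ (v⊑w (suc m))

⊑⇒ascent : (p q : Vec Bool n) → p ⊑ q → Ascent p q
⊑⇒ascent []          []          _ = 0 , nil [] , refl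
⊑⇒ascent (false ∷ v) (false ∷ w) p⊑q = ascent-∷ (⊑⇒ascent v w (∷-⊑ p⊑q))
⊑⇒ascent (true ∷ v)  (true ∷ w)  p⊑q = ascent-∷ (⊑⇒ascent v w (∷-⊑ p⊑q))
⊑⇒ascent (true ∷ v)  (false ∷ w) p⊑q with p⊑q 1
... | ()
⊑⇒ascent (false ∷ v) (true ∷ w)  p⊑q =
  ascent-dropFirstNorth v ⨾ ascent-∷ (⊑⇒ascent (dropFirstNorth v) w (⊑-dropFirstNorth p⊑q))

height-home : ∀ n → height (home n) ≡ 0
height-home zero    = refl
height-home (suc n) = height-home n

home-⊑ : (p : Vec Bool n) → home n ⊑ p
home-⊑ p       zero    = z≤n
home-⊑ []      (suc m) = z≤n
home-⊑ (x ∷ v) (suc m) = ≤-trans (home-⊑ v m) (m≤n+m _ (bit x))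

walk-home⇒height≤ : ∀ {n k} {q : Vec Bool n} → Walk (home n) q k → height q ≤ k
walk-home⇒height≤ {n} {k} {q} w = subst (λ h → height q ≤ h + k) (height-home n) (height-walk w)

from-home-length : ∀ n {k h} → height (home n) + k ≡ h → k ≡ h
from-home-length n {k} e = trans (cong (_+ k) (sym (height-home n))) e

ascent-home⇒shortest : ∀ {n k} {q : Vec Bool n} → height (home n) + k ≡ height q → Shortest (home n) q k
ascent-home⇒shortest {n} e k′ w′ = subst (_≤ k′) (sym (from-home-length n e)) (walk-home⇒height≤ w′)

≤QR⇒⊑ : p ≤QR q → p ⊑ q
≤QR⇒⊑ {n} {p} {q} (k , w , shortest , visit) with visits⇒split w visit | ⊑⇒ascent (home n) q (home-⊑ q)
... | a , b , w₁ , w₂ , a+b≡k | k₀ , w₀ , e₀ = tight-walk⇒⊑ w₂ (begin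
  height p + b ≤⟨ +-monoˡ-≤ b (walk-home⇒height≤ w₁) ⟩
  a + b        ≡⟨ a+b≡k ⟩
  k            ≤⟨ shortest k₀ w₀ ⟩
  k₀           ≡⟨ from-home-length n e₀ ⟩
  height q     ∎)
  where open ≤-Reasoning

⊑⇒≤QR : p ⊑ q → p ≤QR q
⊑⇒≤QR {n} {p} {q} p⊑q with ⊑⇒ascent (home n) p (home-⊑ p) | ⊑⇒ascent p q p⊑q
... | α@(a , w₁ , _) | β@(b , w₂ , _) =
  a + b , w₁ ++ʷ w₂ , ascent-home⇒shortest (proj₂ (proj₂ (α ⨾ β))) , visits-++ w₁ w₂

prefix#≤ : ∀ m (A : Vec Bool n) → prefix# m A ≤ m
prefix#≤ zero    A           = z≤n
prefix#≤ (suc m) []          = z≤n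
prefix#≤ (suc m) (true ∷ A)  = s≤s (prefix#≤ m A)
prefix#≤ (suc m) (false ∷ A) = m≤n⇒m≤1+n (prefix#≤ m A)

prefix#-saturates : ∀ m (A : Vec Bool n) → n ≤ m → prefix# m A ≡ prefix# n A
prefix#-saturates zero    []      _   = refl
prefix#-saturates (suc m) []      _   = refl
prefix#-saturates (suc m) (x ∷ A) n≤m = cong (bit x +_) (prefix#-saturates m A (s≤s⁻¹ n≤m))

private
  shift : ∀ k n d → k + suc n < d → suc k + n < d
  shift k n d = subst (_< d) (+-suc k n)

offset<nth : (A : Vec Bool n) (k j d : ℕ) → k + n < d → k < nthOr d (elemsFrom (suc k) A) j
offset<nth         []          k j       d lt = ≤-trans (s≤s (m≤m+n k 0)) lt
offset<nth         (true ∷ A)  k zero    d lt = n<1+n k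
offset<nth {suc n} (true ∷ A)  k (suc j) d lt = <-trans (n<1+n k) (offset<nth A (suc k) j d (shift k n d lt))
offset<nth {suc n} (false ∷ A) k j       d lt = <-trans (n<1+n k) (offset<nth A (suc k) j d (shift k n d lt))

nth≤default : (A : Vec Bool n) (k j d : ℕ) → k + n < d → nthOr d (elemsFrom (suc k) A) j ≤ d
nth≤default         []          k j       d lt = ≤-refl
nth≤default {suc n} (true ∷ A)  k zero    d lt = ≤-trans (s≤s (m≤m+n k (suc n))) lt
nth≤default {suc n} (true ∷ A)  k (suc j) d lt = nth≤default A (suc k) j d (shift k n d lt)
nth≤default {suc n} (false ∷ A) k j       d lt = nth≤default A (suc k) j d (shift k n d lt)

nth≤⇔<prefix# : (A : Vec Bool n) (k m j d : ℕ) → m ≤ n → k + n < d →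
                nthOr d (elemsFrom (suc k) A) j ≤ k + m ⇔ j < prefix# m A
nth≤⇔<prefix# A k zero j d _ lt =
  mk⇔ (λ le → ⊥-elim (<⇒≱ (offset<nth A k j d lt) (≤-trans le (≤-reflexive (+-identityʳ k))))) (λ ())
nth≤⇔<prefix# (true ∷ A) k (suc m) zero d _ _ =
  mk⇔ (λ _ → s≤s z≤n) (λ _ → ≤-trans (s≤s (m≤m+n k m)) (≤-reflexive (sym (+-suc k m))))
nth≤⇔<prefix# {suc n} (true ∷ A) k (suc m) (suc j) d m≤n lt rewrite +-suc k m =
  mk⇔ (λ le → s≤s (to ih le)) (λ lt′ → from ih (s≤s⁻¹ lt′))
  where ih = nth≤⇔<prefix# A (suc k) m j d (s≤s⁻¹ m≤n) (shift k n d lt)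
nth≤⇔<prefix# {suc n} (false ∷ A) k (suc m) j d m≤n lt rewrite +-suc k m =
  nth≤⇔<prefix# A (suc k) m j d (s≤s⁻¹ m≤n) (shift k n d lt)

-- position A j is a_{j+1}, and n + 1 once j is at least the number of north links.
position : Vec Bool n → ℕ → ℕ
position {n} A j = nthOr (suc n) (elemsFrom 1 A) j

word-lookup : (A : Vec Bool n) (j : Fin n) → lookup (word A) j ≡ position A (toℕ j)
word-lookup A j = lookup∘tabulate _ j

position≤⇔<prefix# : ∀ {m} (A : Vec Bool n) (j : ℕ) → m ≤ n → position A j ≤ m ⇔ j < prefix# m A
position≤⇔<prefix# {n} {m} A j m≤n = nth≤⇔<prefix# A 0 m j (suc n) m≤n ≤-refl

position≤1+n : (A : Vec Bool n) (j : ℕ) → position A j ≤ suc n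
position≤1+n {n} A j = nth≤default A 0 j (suc n) ≤-refl

⊑⇒≤W : (A B : Vec Bool n) → A ⊑ B → A ≤W B
⊑⇒≤W {n} A B A⊑B i rewrite word-lookup A i | word-lookup B i with position A (toℕ i) ≤? n
... | yes a≤n = from (position≤⇔<prefix# B (toℕ i) a≤n)
                  (<-≤-trans (to (position≤⇔<prefix# A (toℕ i) a≤n) ≤-refl) (A⊑B (position A (toℕ i))))
... | no a≰n  = ≤-trans (position≤1+n B (toℕ i)) (≰⇒> a≰n)

≤W⇒position≥ : (A B : Vec Bool n) → A ≤W B → ∀ {j} → j < n → position B j ≤ position A j
≤W⇒position≥ A B A≤B j<n = subst (λ i → position B i ≤ position A i) (toℕ-fromℕ< j<n)
  (subst₂ _≤_ (word-lookup B _) (word-lookup A _) (A≤B (fromℕ< j<n)))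

≤W⇒prefix#≤ : (A B : Vec Bool n) → A ≤W B → ∀ {m} → m ≤ n → prefix# m A ≤ prefix# m B
≤W⇒prefix#≤ A B A≤B {m} m≤n = ≮⇒≥ λ #B<#A → n≮n _ (below-#B (prefix# m B) #B<#A)
  where
  below-#B : ∀ j → j < prefix# m A → j < prefix# m B
  below-#B j j<#A = to (position≤⇔<prefix# B j m≤n) (begin
    position B j ≤⟨ ≤W⇒position≥ A B A≤B (<-≤-trans j<#A (≤-trans (prefix#≤ m A) m≤n)) ⟩
    position A j ≤⟨ from (position≤⇔<prefix# A j m≤n) j<#A ⟩
    m            ∎)
    where open ≤-Reasoning

≤W⇒⊑ : (A B : Vec Bool n) → A ≤W B → A ⊑ B
≤W⇒⊑ {n} A B A≤B m with m ≤? n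
... | yes m≤n = ≤W⇒prefix#≤ A B A≤B m≤n
... | no m≰n rewrite prefix#-saturates m A (<⇒≤ (≰⇒> m≰n)) | prefix#-saturates m B (<⇒≤ (≰⇒> m≰n)) =
  ≤W⇒prefix#≤ A B A≤B ≤-refl

proposition4p4 : (n : ℕ) → 1 ≤ n →
    Σ (State n ↔ State n) λ f →
      (p q : State n) → (p ≤QR q) ⇔ (Inverse.to f p ≤W Inverse.to f q)
proposition4p4 n _ = ↔-id (State n) , λ p q →
  mk⇔ (λ p≤q → ⊑⇒≤W p q (≤QR⇒⊑ p≤q)) (λ p≤q → ⊑⇒≤QR (≤W⇒⊑ p q p≤q))
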